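{- Let $\Gamma\subseteq\mathcal{L}$ be consistent and compositional, and let $\pi,\pi'$ be models of $\Gamma$ with $\pi$ a maximal model of $\Gamma$. Then $V_\pi\supseteq V_{\pi'}$, and $V_\pi=V_{\pi'}$ if and only if $\pi'$ is a maximal model of $\Gamma$. Moreover, if outcomes $\alpha,\beta$ satisfy $\alpha\equiv_\pi\beta$, then $\alpha\equiv_{\pi'}\beta$; in fact $\alpha\equiv_{\pi''}\beta$ holds for every model $\pi''$ of $\Gamma$.
   Context: Let $V$ be a finite set of variables with finite nonempty domains $\underline{X}$; outcomes are full assignments to $V$; $\alpha(U)$ is restriction to $U$. A lex model $\pi$ is a (possibly empty) sequence $(Y_1,\ge_{Y_1}),\ldots,(Y_k,\ge_{Y_k})$ of pairwise distinct variables each with a total order on its domain; $V_\pi=\{Y_1,\ldots,Y_k\}$; $\mathcal{G}$ is the set of lex models; $\alpha\equiv_\pi\beta$ iff $\alpha(V_\pi)=\beta(V_\pi)$. For $\pi'=(Z_1,\ge_{Z_1}),\ldots$, $\pi\circ\pi'$ is $\pi$ followed by $\pi'$ with pairs whose variable is in $V_\pi$ deleted. $\pi'$ extends $\pi$ if $\pi'\ne\pi$ and $\pi'$ begins with $\pi$. $\mathcal{L}$ is an arbitrary set of statements with satisfaction relation $\models\ \subseteq\mathcal{G}\times\mathcal{L}$; $\pi\models\Gamma$ iff $\pi\models\varphi$ for all $\varphi\in\Gamma$ (a model of $\Gamma$); $\Gamma$ is consistent if it has a model; a maximal model of $\Gamma$ is a model of $\Gamma$ such that no lex model extending it is a model of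 $\Gamma$. $\Gamma$ is compositional if for each $\varphi\in\Gamma$ and all $\pi,\pi'\in\mathcal{G}$, $\pi\models\varphi$ and $\pi'\models\varphi$ imply $\pi\circ\pi'\models\varphi$. -}

module Defs where

open import Data.Nat using (ℕ; suc)
open import Data.Fin using (Fin; _≟_)
open import Data.Product using (Σ; Σ-syntax; _,_; proj₁; proj₂; _×_; ∃-syntax)
open import Data.List using (List; []; _∷_; _++_; map; filter)
open import Data.List.Membership.Propositional using (_∈_; _∉_)
open import Data.List.Membership.DecPropositional using () renaming (_∈?_ to ∈?-gen)
open import Data.List.Relation.Unary.All using (All; []; _∷_)
import Data.List.Relation.Unary.All
open import Data.List.Relation.Unary.All.Properties as AllP using ()
open import Data.List.Relation.Unary.AllPairs using (AllPairs; []; _∷_)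
import Data.List.Relation.Unary.AllPairs.Properties as APP
open import Data.List.Relation.Unary.Any using (here; there)
open import Relation.Binary.PropositionalEquality using (_≡_; _≢_; refl)
import Relation.Binary.PropositionalEquality
open import Relation.Binary.Structures using (IsTotalOrder)
open import Relation.Nullary using (¬_; Dec; yes; no; ¬?)
open import Data.Empty using (⊥)

record TotalOrder (A : Set) : Set₁ where
  field
    _≤_         : A → A → Set
    isTotalOrder : IsTotalOrder _≡_ _≤_

module LexSetting (n : ℕ) (d : Fin n → ℕ) where

  Var : Set
  Var = Fin n

  Dom : Var → Set
  Dom i = Fin (suc (d i))

  Outcome : Set
  Outcome = (i : Var) → Dom i

  Entry : Set₁
  Entry = Σ Var (λ i → TotalOrder (Dom i))

  LexModel : Set₁
  LexModel = Σ (List Entry) (AllPairs (λ p q → proj₁ p ≢ proj₁ q))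

  seq : LexModel → List Entry
  seq = proj₁

  vars : LexModel → List Var
  vars π = map proj₁ (seq π)

  _∈V_ : Var → LexModel → Set
  Y ∈V π = Y ∈ vars π

  _∈V?_ : (Y : Var) (π : LexModel) → Dec (Y ∈V π)
  Y ∈V? π = ∈?-gen _≟_ Y (vars π)

  _⊇V_ : LexModel → LexModel → Set
  π ⊇V π' = ∀ Y → Y ∈V π' → Y ∈V π

  _≡V_ : LexModel → LexModel → Set
  π ≡V π' = (π ⊇V π') × (π' ⊇V π)

  _≡[_]_ : Outcome → LexModel → Outcome → Set
  α ≡[ π ] β = ∀ Y → Y ∈V π → α Y ≡ β Y

  private
    keep : LexModel → List Entry → List Entry
    keep π ys = filter (λ p → ¬? (proj₁ p ∈V? π)) ys

    ∉⇒≢ : ∀ (π : LexModel) {p : Entry} → proj₁ p ∉ vars π →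
          All (λ q → proj₁ q ≢ proj₁ p) (seq π)
    ∉⇒≢ (([]) , _) _ = []
    ∉⇒≢ ((q ∷ qs) , (_ ∷ ok)) {p} nm =
      (λ e → nm (here (Relation.Binary.PropositionalEquality.sym e))) ∷ ∉⇒≢ (qs , ok) {p} (λ m → nm (there m))

    disj : ∀ (π : LexModel) (ys : List Entry) →
           All (λ q → All (λ p → proj₁ q ≢ proj₁ p) (keep π ys)) (seq π)
    disj π ys = go (seq π) (AllP.all-filter (λ p → ¬? (proj₁ p ∈V? π)) ys)
      where
      flip : ∀ {zs} → All (λ p → proj₁ p ∉ vars π) zs →
             All (λ q → All (λ p → proj₁ q ≢ proj₁ p) zs) (seq π)
      flip [] = Data.List.Relation.Unary.All.universal (λ _ → []) (seq π)
      flip {p ∷ zs} (nm ∷ rest) =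
        Data.List.Relation.Unary.All.zipWith (λ { (a , b) → a ∷ b }) (∉⇒≢ π {p} nm , flip rest)
      go : List Entry → All (λ p → proj₁ p ∉ vars π) (keep π ys) →
           All (λ q → All (λ p → proj₁ q ≢ proj₁ p) (keep π ys)) (seq π)
      go _ h = flip h

  _∘_ : LexModel → LexModel → LexModel
  π ∘ π' = (seq π ++ keep π (seq π')) ,
           APP.++⁺ (proj₂ π) (APP.filter⁺ _ (proj₂ π')) (disj π (seq π'))

  Extends : LexModel → LexModel → Set₁
  Extends π' π = Σ[ e ∈ Entry ] Σ[ rest ∈ List Entry ] seq π' ≡ seq π ++ (e ∷ rest)

  module Satisfaction (L : Set) (_⊨_ : LexModel → L → Set) where

    _⊨Γ_ : LexModel → (L → Set) → Set
    π ⊨Γ Γ = ∀ φ → Γ φ → π ⊨ φ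

    Consistent : (L → Set) → Set₁
    Consistent Γ = Σ[ π ∈ LexModel ] π ⊨Γ Γ

    MaximalModel : (L → Set) → LexModel → Set₁
    MaximalModel Γ π = (π ⊨Γ Γ) × (∀ π' → Extends π' π → ¬ (π' ⊨Γ Γ))

    Compositional : (L → Set) → Set₁
    Compositional Γ = ∀ φ → Γ φ → ∀ (π π' : LexModel) →
                      π ⊨ φ → π' ⊨ φ → (π ∘ π') ⊨ φ

{-# OPTIONS --safe #-}

-- If π is maximal and π' is any model, compositionality makes π ∘ π' a model; a variable of π'
-- outside V_π would survive in π ∘ π', which would then properly extend π.  Conversely, a model
-- properly extending π' introduces a variable not in V_π', and that variable must lie in V_π.
module Submission where

open import Defs
open import Data.Nat using (ℕ)
open import Data.Fin using (Fin)
open import Data.Product using (_×_; _,_; proj₁; ∃; ∃₂)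
open import Data.List using (List; _∷_; _++_; map)
open import Data.List.Properties using (map-++)
open import Data.List.Membership.Propositional using (_∈_; _∉_)
open import Data.List.Membership.Propositional.Properties using (∈-map⁻; ∈-filter⁺; ∈-++⁺ʳ)
open import Data.List.Relation.Unary.Any using (here; there)
import Data.List.Relation.Unary.All as All
import Data.List.Relation.Unary.All.Properties as All
open import Data.List.Relation.Unary.AllPairs using (_∷_)
import Data.List.Relation.Unary.AllPairs.Properties as AllPairs
open import Data.List.Relation.Unary.Unique.Propositional using (Unique)
open import Relation.Binary.PropositionalEquality using (_≡_; refl; sym; trans; cong; subst)
open import Relation.Nullary using (¬_; yes; no; ¬?)
open import Data.Empty using (⊥-elim)

∈⇒∷ : ∀ {a} {A : Set a} {x : A} {xs : List A} → x ∈ xs → ∃₂ λ y ys → xs ≡ y ∷ ys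
∈⇒∷ {xs = y ∷ ys} _ = y , ys , refl

Unique-++-∷⇒∉ : ∀ {a} {A : Set a} (xs : List A) {y : A} {ys : List A} →
                Unique (xs ++ y ∷ ys) → y ∉ xs
Unique-++-∷⇒∉ (x ∷ xs) (x∉ ∷ _) (here refl) = All.head (All.++⁻ʳ xs x∉) refl
Unique-++-∷⇒∉ (x ∷ xs) (_ ∷ u) (there y∈) = Unique-++-∷⇒∉ xs u y∈

module LexModelProperties (n : ℕ) (d : Fin n → ℕ) where
  open LexSetting n d

  vars-unique : (π : LexModel) → Unique (vars π)
  vars-unique (_ , distinct) = AllPairs.map⁺ distinct

  extends⇒new-var : {π π' : LexModel} → Extends π' π → ∃ λ Y → Y ∈V π' × ¬ Y ∈V π
  extends⇒new-var {π} {π'} (e , rest , π'≡π++e∷rest) = proj₁ e , Y∈π' , Y∉π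
    where
    vars-split : vars π' ≡ vars π ++ proj₁ e ∷ map proj₁ rest
    vars-split = trans (cong (map proj₁) π'≡π++e∷rest) (map-++ proj₁ (seq π) (e ∷ rest))

    Y∈π' : proj₁ e ∈V π'
    Y∈π' = subst (proj₁ e ∈_) (sym vars-split) (∈-++⁺ʳ (vars π) (here refl))

    Y∉π : ¬ proj₁ e ∈V π
    Y∉π = Unique-++-∷⇒∉ (vars π) (subst Unique vars-split (vars-unique π'))

  ∘-extends : {π π' : LexModel} {Y : Var} → Y ∈V π' → ¬ Y ∈V π → Extends (π ∘ π') π
  ∘-extends {π} {π'} Y∈π' Y∉π
    with p , p∈π' , refl ← ∈-map⁻ proj₁ Y∈π'
    with e , rest , kept≡e∷rest ← ∈⇒∷ (∈-filter⁺ (λ q → ¬? (proj₁ q ∈V? π)) p∈π' Y∉π)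
    = e , rest , cong (seq π ++_) kept≡e∷rest

  ≡[]-antitone : {π π' : LexModel} {α β : Outcome} → π ⊇V π' → α ≡[ π ] β → α ≡[ π' ] β
  ≡[]-antitone π⊇π' α≡β Y Y∈π' = α≡β Y (π⊇π' Y Y∈π')

  module MaximalModelProperties (L : Set) (_⊨_ : LexModel → L → Set) {Γ : L → Set}
                                (compositional : Satisfaction.Compositional L _⊨_ Γ) where
    open Satisfaction L _⊨_

    ∘-⊨Γ : {π π' : LexModel} → π ⊨Γ Γ → π' ⊨Γ Γ → (π ∘ π') ⊨Γ Γ
    ∘-⊨Γ {π} {π'} π⊨ π'⊨ φ φ∈Γ = compositional φ φ∈Γ π π' (π⊨ φ φ∈Γ) (π'⊨ φ φ∈Γ)

    maximal-⊇V : {π π' : LexModel} → MaximalModel Γ π → π' ⊨Γ Γ → π ⊇V π'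
    maximal-⊇V {π} {π'} (π⊨ , maximal) π'⊨ Y Y∈π' with Y ∈V? π
    ... | yes Y∈π = Y∈π
    ... | no Y∉π = ⊥-elim (maximal (π ∘ π') (∘-extends {π} {π'} Y∈π' Y∉π) (∘-⊨Γ π⊨ π'⊨))

    ⊇V-maximal⇒maximal : {π π' : LexModel} → MaximalModel Γ π → π' ⊨Γ Γ → π' ⊇V π →
                         MaximalModel Γ π'
    ⊇V-maximal⇒maximal {π} {π'} πmax π'⊨ π'⊇π = π'⊨ , λ π'' π''-extends π''⊨ →
      let Y , Y∈π'' , Y∉π' = extends⇒new-var {π'} {π''} π''-extends
      in Y∉π' (π'⊇π Y (maximal-⊇V πmax π''⊨ Y Y∈π''))

proposition2 : (n : ℕ) (d : Fin n → ℕ) (L : Set)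
               (_⊨_ : LexSetting.LexModel n d → L → Set) (Γ : L → Set) →
               let open LexSetting n d
                   open Satisfaction L _⊨_
               in Consistent Γ → Compositional Γ →
                  (π π' : LexModel) → MaximalModel Γ π → π' ⊨Γ Γ →
                  (π ⊇V π')
                  × (((π ≡V π') → MaximalModel Γ π') × (MaximalModel Γ π' → (π ≡V π')))
                  × (∀ (α β : Outcome) → α ≡[ π ] β →
                       (α ≡[ π' ] β) × (∀ (π'' : LexModel) → π'' ⊨Γ Γ → α ≡[ π'' ] β))
proposition2 n d L _⊨_ Γ _ compositional π π' πmax π'⊨ =
  π⊇π' ,
  ((λ (_ , π'⊇π) → ⊇V-maximal⇒maximal πmax π'⊨ π'⊇π) ,
   (λ π'max → π⊇π' , maximal-⊇V π'max (proj₁ πmax))) ,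
  λ α β α≡β → ≡[]-antitone {π} {π'} π⊇π' α≡β ,
              λ π'' π''⊨ → ≡[]-antitone {π} {π''} (maximal-⊇V πmax π''⊨) α≡β
  where
  open LexSetting n d
  open LexModelProperties n d
  open MaximalModelProperties L _⊨_ compositional

  π⊇π' : π ⊇V π'
  π⊇π' = maximal-⊇V πmax π'⊨
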